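{- For every positive integer $n$, the total number of records, summed over all rooted trees with vertex set $[n]$, equals the number of connected endofunctions on $[n]$.
   Context: A rooted tree on $[n]$ is a labeled tree with vertex set $[n]=\{1,\dots,n\}$ and a distinguished root; a node is a record if its label is the largest on the path from it to the root (inclusive). An endofunction on $[n]$ is a map $[n]\to[n]$; it is connected if its functional graph (edges $i\to f(i)$) is connected when orientations are ignored. -}

module Defs where

open import Data.Nat using (ℕ; _≤_)
open import Data.Fin using (Fin; toℕ)
open import Data.Maybe using (Maybe; just; nothing)
open import Data.Vec using (Vec; lookup)
open import Data.List using (List; length)
open import Data.List.Membership.Propositional using (_∈_)
open import Data.List.Relation.Unary.Unique.Propositional using (Unique)
open import Data.Product using (Σ; _×_; ∃; _,_)
open import Data.Sum using (_⊎_)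
open import Function.Bundles using (_⇔_)
open import Relation.Binary.PropositionalEquality using (_≡_)
open import Relation.Binary.Construct.Closure.ReflexiveTransitive using (Star)

-- Finite counting: `HasCount A P k` says that exactly k elements of A
-- satisfy P, witnessed by a duplicate-free list enumerating them.

HasCount : (A : Set) → (A → Set) → ℕ → Set
HasCount A P k =
  Σ (List A) λ xs → Unique xs × (length xs ≡ k) × (∀ x → (x ∈ xs) ⇔ P x)

-- Rooted trees on [n] (vertices Fin n, labels ordered by toℕ), encoded by
-- their parent map: par v = just w  if w is the parent of v,
--                   par v = nothing if v is the root.

ParentMap : ℕ → Set
ParentMap n = Vec (Maybe (Fin n)) n

data ReachesRoot {n : ℕ} (par : ParentMap n) : Fin n → Set where
  atRoot : ∀ {v} → lookup par v ≡ nothing → ReachesRoot par v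
  step   : ∀ {v w} → lookup par v ≡ just w → ReachesRoot par w → ReachesRoot par v

IsRootedTree : {n : ℕ} → ParentMap n → Set
IsRootedTree {n} par =
  (∀ v → ReachesRoot par v) ×
  (∀ r s → lookup par r ≡ nothing → lookup par s ≡ nothing → r ≡ s)

data OnPath {n : ℕ} (par : ParentMap n) : Fin n → Fin n → Set where
  here  : ∀ {v} → OnPath par v v
  there : ∀ {v w u} → lookup par v ≡ just w → OnPath par w u → OnPath par v u

IsRecord : {n : ℕ} → ParentMap n → Fin n → Set
IsRecord par v = ∀ u → OnPath par v u → toℕ u ≤ toℕ v

-- pairs (rooted tree, record node of it); their number is the total number
-- of records summed over all rooted trees on [n]
TreeRecord : {n : ℕ} → ParentMap n × Fin n → Set
TreeRecord (par , v) = IsRootedTree par × IsRecord par v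

Endo : ℕ → Set
Endo n = Vec (Fin n) n

Adj : {n : ℕ} → Endo n → Fin n → Fin n → Set
Adj f i j = (lookup f i ≡ j) ⊎ (lookup f j ≡ i)

IsConnected : {n : ℕ} → Endo n → Set
IsConnected f = ∀ i j → Star (Adj f) i j

-- A rooted tree with a marked record v is sent to the endofunction mapping every vertex to its
-- parent and the root to v. Its functional graph is connected, and its unique cycle is the path
-- from v to the root closed up by the edge root ↦ v; as v is a record, it is the largest vertex
-- on that cycle. Hence the pair is recovered from the endofunction: v is the maximum of the
-- cycle, the root is its predecessor there, and the parent map is the endofunction with the
-- edge leaving the root removed. Conversely, cutting the cycle of a connected endofunction just
-- before its largest vertex m leaves a tree rooted at the predecessor of m, in which m is a
-- record.
{-# OPTIONS --safe #-}
module Submission where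

open import Defs
open import Data.Nat using (ℕ; _≤_)
open import Data.Fin using (Fin)
open import Data.Product using (Σ; _×_)

open import Data.Bool using (if_then_else_)
open import Data.Empty using (⊥; ⊥-elim)
open import Data.Fin using (toℕ) renaming (_≟_ to _≟ᶠ_)
import Data.Fin as Fin
open import Data.Fin.Properties using (toℕ-injective; toℕ<n; pigeonhole; all?)
open import Data.List using (List; []; _∷_; length; map; filter; cartesianProductWith; upTo; allFin)
open import Data.List.Membership.Propositional using (_∈_)
open import Data.List.Membership.Propositional.Properties
  using (∈-map⁺; ∈-map⁻; ∈-filter⁺; ∈-filter⁻; ∈-cartesianProductWith⁺; ∈-upTo⁺; ∈-allFin)
open import Data.List.Properties using (length-map)
open import Data.List.Relation.Unary.All as All using ()
open import Data.List.Relation.Unary.Any using (here)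
open import Data.List.Relation.Unary.AllPairs using ([]; _∷_)
open import Data.List.Relation.Unary.Unique.Propositional using (Unique)
open import Data.List.Relation.Unary.Unique.Propositional.Properties
  using (map⁺; filter⁺; cartesianProductWith⁺; allFin⁺)
open import Data.Maybe using (just; nothing; fromMaybe)
open import Data.Maybe.Properties using (just-injective)
open import Data.Nat using (zero; suc; _+_; _*_; _<_; _≟_; z≤n; s≤s; s≤s⁻¹)
open import Data.Nat.GeneralisedArithmetic using (fold; fold-+)
open import Data.Nat.Properties
  using ( ≤-trans; ≤-antisym; <-≤-trans; ≤∧≢⇒<; n<1+n; +-comm; *-suc; m≤n⇒∃[o]m+o≡n; anyUpTo?
        ; ≤-totalOrder)
open import Data.List.Extrema ≤-totalOrder using (argmax; f[xs]≤f[argmax])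
open import Data.Product using (_,_; proj₁; proj₂; ∃; ∃-syntax; ∃₂)
open import Data.Sum using (inj₁; inj₂)
import Data.Sum as Sum
open import Data.Vec using (Vec; lookup; tabulate)
import Data.Vec as Vec
open import Data.Vec.Properties
  using (lookup-map; lookup∘tabulate; tabulate∘lookup; tabulate-cong; ∷-injective)
open import Function using (_∘_; id)
open import Function.Bundles using (_⇔_; mk⇔; Equivalence)
open import Relation.Binary.Construct.Closure.ReflexiveTransitive as Star using (Star; ε; _◅_; _◅◅_)
open import Relation.Binary.PropositionalEquality
  using (_≡_; _≢_; refl; sym; trans; cong; cong₂; subst; module ≡-Reasoning)
open import Relation.Nullary using (yes; no; does)
open import Relation.Nullary.Decidable using (dec-true; dec-false)
import Relation.Nullary.Decidable as Dec
open import Relation.Unary using (Decidable)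

private
  variable
    n : ℕ
    A B : Set

filter-hasCount : {P : A → Set} {xs : List A} → Unique xs → (∀ x → x ∈ xs) →
                  (P? : Decidable P) → HasCount A P (length (filter P? xs))
filter-hasCount {xs = xs} unique complete P? =
  filter P? xs , filter⁺ P? unique , refl ,
  λ x → mk⇔ (proj₂ ∘ ∈-filter⁻ P? {xs = xs}) (∈-filter⁺ P? (complete x))

hasCount-section : {P : A → Set} {Q : B → Set} {k : ℕ} (φ : A → B) (ψ : B → A) →
                   (∀ b → φ (ψ b) ≡ b) → (∀ b → Q b → P (ψ b)) → (∀ a → P a → Q (φ a)) →
                   (∀ a a′ → P a → P a′ → φ a ≡ φ a′ → a ≡ a′) →
                   HasCount B Q k → HasCount A P k
hasCount-section {P = P} φ ψ φ∘ψ ψ-pres φ-pres φ-injective (ys , unique , len , mem) =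
  map ψ ys , map⁺ ψ-injective unique , trans (length-map ψ ys) len , λ a → mk⇔ to from
  where
  ψ-injective : ∀ {b b′} → ψ b ≡ ψ b′ → b ≡ b′
  ψ-injective {b} {b′} eq = trans (sym (φ∘ψ b)) (trans (cong φ eq) (φ∘ψ b′))
  to : ∀ {a} → a ∈ map ψ ys → P a
  to a∈ with b , b∈ , refl ← ∈-map⁻ ψ a∈ = ψ-pres b (Equivalence.to (mem b) b∈)
  from : ∀ {a} → P a → a ∈ map ψ ys
  from {a} pa = subst (_∈ map ψ ys) ψ∘φ (∈-map⁺ ψ φa∈)
    where
    φa∈ : φ a ∈ ys
    φa∈ = Equivalence.from (mem (φ a)) (φ-pres a pa)
    ψ∘φ : ψ (φ a) ≡ a
    ψ∘φ = φ-injective (ψ (φ a)) a (ψ-pres (φ a) (φ-pres a pa)) pa (φ∘ψ (φ a))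

vecs : List A → (k : ℕ) → List (Vec A k)
vecs xs zero    = Vec.[] ∷ []
vecs xs (suc k) = cartesianProductWith Vec._∷_ xs (vecs xs k)

vecs-unique : {xs : List A} → Unique xs → ∀ k → Unique (vecs xs k)
vecs-unique unique zero    = All.[] ∷ []
vecs-unique unique (suc k) = cartesianProductWith⁺ Vec._∷_ ∷-injective unique (vecs-unique unique k)

vecs-complete : {xs : List A} {k : ℕ} → (∀ x → x ∈ xs) → (v : Vec A k) → v ∈ vecs xs k
vecs-complete complete Vec.[]       = here refl
vecs-complete complete (x Vec.∷ v) =
  ∈-cartesianProductWith⁺ Vec._∷_ (complete x) (vecs-complete complete v)

vec-ext : {xs ys : Vec A n} → (∀ i → lookup xs i ≡ lookup ys i) → xs ≡ ys
vec-ext {xs = xs} {ys} eq =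
  trans (sym (tabulate∘lookup xs)) (trans (tabulate-cong eq) (tabulate∘lookup ys))

-- Orbits of a self-map

module Orbit {A : Set} (F : A → A) where
  open ≡-Reasoning

  Reaches : A → A → Set
  Reaches x y = ∃[ k ] fold x F k ≡ y

  Periodic : A → Set
  Periodic x = ∃[ e ] fold x F (suc e) ≡ x

  fold-shift : ∀ x k → fold x F (suc k) ≡ fold (F x) F k
  fold-shift x k = trans (cong (fold x F) (+-comm 1 k)) (fold-+ x F k)

  reaches-snoc : ∀ {x y z} → Reaches x y → F y ≡ z → Reaches x z
  reaches-snoc (k , refl) refl = suc k , refl

  reaches-cons : ∀ {x y z} → F x ≡ y → Reaches y z → Reaches x z
  reaches-cons {x} refl (k , eq) = suc k , trans (fold-shift x k) eq

  orbit-bounded : ∀ {x a b} → a < b → fold x F a ≡ fold x F b →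
                  ∀ k → ∃[ r ] r < b × fold x F k ≡ fold x F r
  orbit-bounded a<b eq zero = zero , ≤-trans (s≤s z≤n) a<b , refl
  orbit-bounded {x} {a} {b} a<b eq (suc k) with orbit-bounded a<b eq k
  ... | r , r<b , e with suc r ≟ b
  ...   | yes r+1≡b = a , a<b , trans (cong F e) (trans (cong (fold x F) r+1≡b) (sym eq))
  ...   | no r+1≢b  = suc r , ≤∧≢⇒< r<b r+1≢b , cong F e

  eventually-periodic : ∀ {x a b} → a < b → fold x F a ≡ fold x F b → Periodic (fold x F a)
  eventually-periodic {x} {a} {b} a<b eq with e , a+1+e≡b ← m≤n⇒∃[o]m+o≡n a<b = e , (begin
    fold (fold x F a) F (suc e) ≡⟨ fold-+ x F (suc e) ⟨
    fold x F (suc e + a)        ≡⟨ cong (fold x F) (trans (cong suc (+-comm e a)) a+1+e≡b) ⟩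
    fold x F b                  ≡⟨ eq ⟨
    fold x F a                  ∎)

  periodic-fold : ∀ {x} → Periodic x → ∀ k → Periodic (fold x F k)
  periodic-fold {x} (e , per) k = e , (begin
    fold (fold x F k) F (suc e) ≡⟨ fold-+ x F (suc e) ⟨
    fold x F (suc e + k)        ≡⟨ cong (fold x F) (+-comm (suc e) k) ⟩
    fold x F (k + suc e)        ≡⟨ fold-+ x F k ⟩
    fold (fold x F (suc e)) F k ≡⟨ cong (λ y → fold y F k) per ⟩
    fold x F k                  ∎)

  fold-period-multiple : ∀ {x e} → fold x F (suc e) ≡ x → ∀ t → fold x F (t * suc e) ≡ x
  fold-period-multiple per zero = refl
  fold-period-multiple {x} {e} per (suc t) = begin
    fold x F (suc e + t * suc e)          ≡⟨ fold-+ x F (suc e) ⟩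
    fold (fold x F (t * suc e)) F (suc e) ≡⟨ cong (λ y → fold y F (suc e)) (fold-period-multiple per t) ⟩
    fold x F (suc e)                      ≡⟨ per ⟩
    x                                     ∎

  periodic-return : ∀ {x y} → Periodic x → Reaches x y → Reaches y x
  periodic-return {x} (e , per) (a , refl) = a * e , (begin
    fold (fold x F a) F (a * e) ≡⟨ fold-+ x F (a * e) ⟨
    fold x F (a * e + a)        ≡⟨ cong (fold x F) (trans (+-comm (a * e) a) (sym (*-suc a e))) ⟩
    fold x F (a * suc e)        ≡⟨ fold-period-multiple per a ⟩
    x                           ∎)

module FinOrbit {n : ℕ} (F : Fin n → Fin n) where
  open Orbit F

  IsOrbitMax : Fin n → Set
  IsOrbitMax x = ∀ k → toℕ (fold x F k) ≤ toℕ x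

  orbit-collision : ∀ x → ∃₂ λ a b → a < b × b ≤ n × fold x F a ≡ fold x F b
  orbit-collision x with i , j , i<j , eq ← pigeonhole (n<1+n n) (λ i → fold x F (toℕ i)) =
    toℕ i , toℕ j , i<j , s≤s⁻¹ (toℕ<n j) , eq

  orbit-finite : ∀ x k → ∃[ r ] r < n × fold x F k ≡ fold x F r
  orbit-finite x k with a , b , a<b , b≤n , eq ← orbit-collision x
                   with r , r<b , e ← orbit-bounded a<b eq k = r , <-≤-trans r<b b≤n , e

  periodic-point : Fin n → ∃ Periodic
  periodic-point x with a , b , a<b , _ , eq ← orbit-collision x =
    fold x F a , eventually-periodic a<b eq

  periodic-orbit-max : ∀ {c} → Periodic c → ∃[ m ] Periodic m × IsOrbitMax m
  periodic-orbit-max {c} c-periodic = fold c F j , periodic-fold c-periodic j , maximal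
    where
    value : ℕ → ℕ
    value i = toℕ (fold c F i)
    j : ℕ
    j = argmax value 0 (upTo n)
    maximal : IsOrbitMax (fold c F j)
    maximal k with r , r<n , eq ← orbit-finite c (k + j) =
      subst (λ y → toℕ y ≤ value j) (trans (sym eq) (fold-+ c F k))
            (All.lookup (f[xs]≤f[argmax] 0 (upTo n)) (∈-upTo⁺ r<n))

-- Connectivity of functional graphs

module Connectivity (f : Endo n) where
  open Orbit (lookup f)

  star-fold : ∀ x k → Star (Adj f) x (fold x (lookup f) k)
  star-fold x zero    = ε
  star-fold x (suc k) = star-fold x k ◅◅ inj₁ refl ◅ ε

  common-reach-star : ∀ {x y c} → Reaches x c → Reaches y c → Star (Adj f) x y
  common-reach-star {x} {y} (k , refl) (l , eq) =
    star-fold x k ◅◅ Star.reverse Sum.swap (subst (Star (Adj f) y) eq (star-fold y l))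

  reaches-along : ∀ {c u w} → Periodic c → Adj f u w → Reaches u c → Reaches w c
  reaches-along {c} (e , per) (inj₁ refl) (zero , refl) = e , trans (sym (fold-shift c e)) per
  reaches-along {u = u} _ (inj₁ refl) (suc k , eq) = k , trans (sym (fold-shift u k)) eq
  reaches-along _ (inj₂ Fw≡u) u⇝c = reaches-cons Fw≡u u⇝c

  connected-reaches : ∀ {c} → Periodic c → IsConnected f → ∀ x → Reaches x c
  connected-reaches {c} c-periodic connected x =
    Star.fold (λ u w → Reaches u c → Reaches w c) (λ a k → k ∘ reaches-along c-periodic a) id
              (connected c x) (zero , refl)

connected? : Decidable (IsConnected {n})
connected? {zero}  f = yes λ ()
connected? {suc n} f =
  Dec.map bounded⇔connected (all? λ x → anyUpTo? (λ r → fold x (lookup f) r ≟ᶠ c) (suc n))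
  where
  open Orbit (lookup f)
  open FinOrbit (lookup f)
  open Connectivity f
  c : Fin (suc n)
  c = proj₁ (periodic-point Fin.zero)
  c-periodic : Periodic c
  c-periodic = proj₂ (periodic-point Fin.zero)
  Bounded : Fin (suc n) → Set
  Bounded x = ∃[ r ] r < suc n × fold x (lookup f) r ≡ c
  bounded⇔connected : (∀ x → Bounded x) ⇔ IsConnected f
  bounded⇔connected = mk⇔ to from
    where
    to : (∀ x → Bounded x) → IsConnected f
    to bounded i j with r , _ , eq ← bounded i | s , _ , eq′ ← bounded j =
      common-reach-star (r , eq) (s , eq′)
    from : IsConnected f → ∀ x → Bounded x
    from connected x with k , eq ← connected-reaches c-periodic connected x
                     with r , r<n , eq′ ← orbit-finite x k = r , r<n , trans (sym eq′) eq

private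
  nothing≢just : {x : A} → nothing ≢ just x
  nothing≢just ()

module _ {par : ParentMap n} where

  reachesRoot-root : ∀ {x} → ReachesRoot par x → ∃[ r ] lookup par r ≡ nothing × OnPath par x r
  reachesRoot-root {x} (atRoot root) = x , root , here
  reachesRoot-root (step parent rr) with r , root , path ← reachesRoot-root rr =
    r , root , there parent path

  onPath-snoc : ∀ {x y w} → OnPath par x y → lookup par y ≡ just w → OnPath par x w
  onPath-snoc here                 parent = there parent here
  onPath-snoc (there parent′ path) parent = there parent′ (onPath-snoc path parent)

  no-cycle : ∀ {x y w} → ReachesRoot par y → OnPath par y x → lookup par x ≡ just w →
             OnPath par w y → ⊥
  no-cycle (atRoot root) here             parent _ = nothing≢just (trans (sym root) parent)
  no-cycle (atRoot root) (there parent _) _      _ = nothing≢just (trans (sym root) parent)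
  no-cycle (step parent rr) here parent′ w⇝y
    with refl ← just-injective (trans (sym parent) parent′) = no-cycle rr w⇝y parent here
  no-cycle (step parent rr) (there parent′ y⇝x) parent″ w⇝y
    with refl ← just-injective (trans (sym parent) parent′) =
    no-cycle rr y⇝x parent″ (onPath-snoc w⇝y parent)

toEndo : ParentMap n × Fin n → Endo n
toEndo (par , v) = Vec.map (fromMaybe v) par

record Encodes (f : Endo n) (par : ParentMap n) (v : Fin n) : Set where
  constructor encodes
  field lookup-encodes : ∀ u → lookup f u ≡ fromMaybe v (lookup par u)
open Encodes

toEndo-encodes : (par : ParentMap n) (v : Fin n) → Encodes (toEndo (par , v)) par v
toEndo-encodes par v = encodes λ u → lookup-map u (fromMaybe v) par

encodes⇒toEndo : ∀ {f : Endo n} {par v} → Encodes f par v → f ≡ toEndo (par , v)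
encodes⇒toEndo {par = par} {v} enc =
  vec-ext λ u → trans (lookup-encodes enc u) (sym (lookup-encodes (toEndo-encodes par v) u))

module Encoding {f : Endo n} {par : ParentMap n} {v : Fin n} (enc : Encodes f par v) where
  open Orbit (lookup f)

  parent-image : ∀ {x w} → lookup par x ≡ just w → lookup f x ≡ w
  parent-image {x} parent = trans (lookup-encodes enc x) (cong (fromMaybe v) parent)

  root-image : ∀ {r} → lookup par r ≡ nothing → lookup f r ≡ v
  root-image {r} root = trans (lookup-encodes enc r) (cong (fromMaybe v) root)

  onPath-reaches : ∀ {x u} → OnPath par x u → Reaches x u
  onPath-reaches here                = zero , refl
  onPath-reaches (there parent path) = reaches-cons (parent-image parent) (onPath-reaches path)

  reaches-root : ∀ {x} → ReachesRoot par x → ∃[ r ] lookup par r ≡ nothing × Reaches x r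
  reaches-root rr with r , root , path ← reachesRoot-root rr = r , root , onPath-reaches path

  orbit-onPath : ∀ k → OnPath par v (fold v (lookup f) k)
  orbit-onPath zero = here
  orbit-onPath (suc k) with lookup par (fold v (lookup f) k) in parent
  ... | nothing = subst (OnPath par v) (sym (root-image parent)) here
  ... | just w  =
    subst (OnPath par v) (sym (parent-image parent)) (onPath-snoc (orbit-onPath k) parent)

  periodic : ReachesRoot par v → Periodic v
  periodic rr with r , root , (k , refl) ← reaches-root rr = k , root-image root

  connected : IsRootedTree par → IsConnected f
  connected (rr , root-unique) i j
    with ri , rooti , i⇝ri ← reaches-root (rr i) | rj , rootj , j⇝rj ← reaches-root (rr j) =
    Connectivity.common-reach-star f i⇝ri (subst (Reaches j) (root-unique rj ri rootj rooti) j⇝rj)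

-- Cutting a functional graph

cut : Endo n → Fin n → ParentMap n
cut f p = tabulate λ u → if does (u ≟ᶠ p) then nothing else just (lookup f u)

module _ (f : Endo n) (p : Fin n) where
  open Orbit (lookup f)
  open FinOrbit (lookup f)

  cut-root : lookup (cut f p) p ≡ nothing
  cut-root = trans (lookup∘tabulate _ p)
                   (cong (if_then nothing else just (lookup f p)) (dec-true (p ≟ᶠ p) refl))

  cut-nonroot : ∀ {u} → u ≢ p → lookup (cut f p) u ≡ just (lookup f u)
  cut-nonroot {u} u≢p = trans (lookup∘tabulate _ u)
                              (cong (if_then nothing else just (lookup f u)) (dec-false (u ≟ᶠ p) u≢p))

  cut-root-unique : ∀ {u} → lookup (cut f p) u ≡ nothing → u ≡ p
  cut-root-unique {u} root with u ≟ᶠ p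
  ... | yes u≡p = u≡p
  ... | no  u≢p = ⊥-elim (nothing≢just (trans (sym root) (cut-nonroot u≢p)))

  cut-encodes : Encodes f (cut f p) (lookup f p)
  cut-encodes = encodes lookup-cut
    where
    lookup-cut : ∀ u → lookup f u ≡ fromMaybe (lookup f p) (lookup (cut f p) u)
    lookup-cut u with u ≟ᶠ p
    ... | yes refl = sym (cong (fromMaybe (lookup f p)) cut-root)
    ... | no  u≢p  = sym (cong (fromMaybe (lookup f p)) (cut-nonroot u≢p))

  reaches-reachesRoot : ∀ {x} k → fold x (lookup f) k ≡ p → ReachesRoot (cut f p) x
  reaches-reachesRoot {x} k x⇝p with x ≟ᶠ p
  ... | yes refl = atRoot cut-root
  reaches-reachesRoot zero    x⇝p | no x≢p = ⊥-elim (x≢p x⇝p)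
  reaches-reachesRoot {x} (suc k) x⇝p | no x≢p =
    step (cut-nonroot x≢p) (reaches-reachesRoot k (trans (sym (fold-shift x k)) x⇝p))

  cut-isRootedTree : Periodic p → IsConnected f → IsRootedTree (cut f p)
  cut-isRootedTree p-periodic connected =
    (λ x → let k , x⇝p = Connectivity.connected-reaches f p-periodic connected x
           in reaches-reachesRoot k x⇝p) ,
    (λ r s root root′ → trans (cut-root-unique root) (sym (cut-root-unique root′)))

  cut-isRecord : IsOrbitMax (lookup f p) → IsRecord (cut f p) (lookup f p)
  cut-isRecord maximal u path with k , refl ← Encoding.onPath-reaches cut-encodes path = maximal k

encodes⇒cut : ∀ {f : Endo n} {par v r} → Encodes f par v →
              (∀ s → lookup par s ≡ nothing → s ≡ r) → lookup par r ≡ nothing → par ≡ cut f r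
encodes⇒cut {f = f} {par} {r = r} enc root-unique root = vec-ext parents
  where
  parents : ∀ u → lookup par u ≡ lookup (cut f r) u
  parents u with u ≟ᶠ r | lookup par u in parent
  ... | yes refl | _      = trans (sym parent) (trans root (sym (cut-root f r)))
  ... | no  u≢r  | nothing = ⊥-elim (u≢r (root-unique u parent))
  ... | no  u≢r  | just w  =
    trans (cong just (sym (Encoding.parent-image enc parent))) (sym (cut-nonroot f r u≢r))

-- Injectivity of the encoding

module _ {f : Endo n} where
  open Orbit (lookup f)

  -- v′ lies on the cycle of f, and in par the cycle through v is the path from v to the root.
  marker≤record : ∀ {par par′ v v′} → Encodes f par v → Encodes f par′ v′ →
                  ReachesRoot par v′ → IsRecord par v → ReachesRoot par′ v′ → toℕ v′ ≤ toℕ v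
  marker≤record {v = v} {v′} enc enc′ rr isRecord rr′ =
    subst (λ u → toℕ u ≤ toℕ v) (proj₂ v⇝v′) (isRecord _ (E.orbit-onPath (proj₁ v⇝v′)))
    where
    module E = Encoding enc
    v′⇝v : Reaches v′ v
    v′⇝v with r , root , v′⇝r ← E.reaches-root rr = reaches-snoc v′⇝r (E.root-image root)
    v⇝v′ : Reaches v v′
    v⇝v′ = periodic-return (Encoding.periodic enc′ rr′) v′⇝v

  root-shared : ∀ {par par′ v r} → Encodes f par v → Encodes f par′ v → ReachesRoot par v →
                OnPath par′ v r → lookup par′ r ≡ nothing → lookup par r ≡ nothing
  root-shared {par} {v = v} {r} enc enc′ rr path′ root′ with lookup par r in parent
  ... | nothing = refl
  ... | just w  = ⊥-elim (no-cycle rr path parent-v here)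
    where
    path : OnPath par v r
    path with k , refl ← Encoding.onPath-reaches enc′ path′ = Encoding.orbit-onPath enc k
    parent-v : lookup par r ≡ just v
    parent-v = trans parent (cong just (trans (sym (Encoding.parent-image enc parent))
                                              (Encoding.root-image enc′ root′)))

  markers-coincide : ∀ {par par′ v v′} → Encodes f par v → Encodes f par′ v′ →
                     TreeRecord (par , v) → TreeRecord (par′ , v′) → v ≡ v′
  markers-coincide {v = v} {v′} enc enc′ ((rr , _) , isRecord) ((rr′ , _) , isRecord′) =
    toℕ-injective (≤-antisym (marker≤record enc′ enc (rr′ v) isRecord′ (rr v))
                             (marker≤record enc enc′ (rr v′) isRecord (rr′ v′)))

  parents-coincide : ∀ {par par′ v} → Encodes f par v → Encodes f par′ v →
                     IsRootedTree par → IsRootedTree par′ → par ≡ par′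
  parents-coincide {par} {v = v} enc enc′ (rr , root-unique) (rr′ , root-unique′)
    with r , root′ , path′ ← reachesRoot-root (rr′ v) =
    trans (encodes⇒cut enc (λ s root-s → root-unique s r root-s root) root)
          (sym (encodes⇒cut enc′ (λ s root-s → root-unique′ s r root-s root′) root′))
    where
    root : lookup par r ≡ nothing
    root = root-shared enc enc′ (rr v) path′ root′

toEndo-injective : (x y : ParentMap n × Fin n) → TreeRecord x → TreeRecord y →
                   toEndo x ≡ toEndo y → x ≡ y
toEndo-injective (par , v) (par′ , v′) tx ty same =
  cong₂ _,_ (parents-coincide enc (subst (Encodes f par′) (sym v≡v′) enc′) (proj₁ tx) (proj₁ ty)) v≡v′
  where
  f : Endo _
  f = toEndo (par , v)
  enc : Encodes f par v
  enc = toEndo-encodes par v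
  enc′ : Encodes f par′ v′
  enc′ = encodes λ u →
    trans (cong (λ g → lookup g u) same) (lookup-encodes (toEndo-encodes par′ v′) u)
  v≡v′ : v ≡ v′
  v≡v′ = markers-coincide enc enc′ tx ty

toEndo-connected : (x : ParentMap n × Fin n) → TreeRecord x → IsConnected (toEndo x)
toEndo-connected (par , v) (tree , _) = Encoding.connected (toEndo-encodes par v) tree

-- The inverse map

module _ (f : Endo (suc n)) where
  open Orbit (lookup f)
  open FinOrbit (lookup f)

  predecessor-of-cycle-max : ∃[ p ] Periodic p × IsOrbitMax (lookup f p)
  predecessor-of-cycle-max =
    let m , m-periodic , m-max = periodic-orbit-max (proj₂ (periodic-point Fin.zero))
        e , per = m-periodic
    in fold m (lookup f) e , periodic-fold m-periodic e , subst IsOrbitMax (sym per) m-max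

  fromEndo : ParentMap (suc n) × Fin (suc n)
  fromEndo = let p , _ = predecessor-of-cycle-max in cut f p , lookup f p

  toEndo∘fromEndo : toEndo fromEndo ≡ f
  toEndo∘fromEndo = sym (encodes⇒toEndo (cut-encodes f _))

  fromEndo-treeRecord : IsConnected f → TreeRecord fromEndo
  fromEndo-treeRecord connected =
    let p , p-periodic , p-max = predecessor-of-cycle-max
    in cut-isRootedTree f p p-periodic connected , cut-isRecord f p p-max

corollary1p2 : (n : ℕ) → 1 ≤ n →
    Σ ℕ λ k → HasCount (ParentMap n × Fin n) TreeRecord k × HasCount (Endo n) IsConnected k
corollary1p2 (suc n) _ =
  _ , hasCount-section toEndo fromEndo toEndo∘fromEndo fromEndo-treeRecord toEndo-connected
                       toEndo-injective connected-count
    , connected-count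
  where
  endos : List (Endo (suc n))
  endos = vecs (allFin (suc n)) (suc n)
  connected-count : HasCount (Endo (suc n)) IsConnected (length (filter connected? endos))
  connected-count =
    filter-hasCount (vecs-unique (allFin⁺ (suc n)) (suc n)) (vecs-complete ∈-allFin) connected?
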